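{- The theory of partially ordered sets with a binary operation $f$ which is order preserving in each argument (i.e. $x\leq x'$ implies $f(x,y)\leq f(x',y)$ and $y\leq y'$ implies $f(x,y)\leq f(x,y')$) does not have APU.
   Context: Embeddings are injective maps preserving the operation and preserving and reflecting the order. A class $\mathcal K$ has APU if whenever $\mathbf A,\mathbf B,\mathbf C\in\mathcal K$ and $\iota_1:\mathbf C\to\mathbf A$, $\iota_2:\mathbf C\to\mathbf B$ are embeddings, there are $\mathbf D\in\mathcal K$ and embeddings $\kappa_1:\mathbf A\to\mathbf D$, $\kappa_2:\mathbf B\to\mathbf D$ with $\kappa_1\iota_1=\kappa_2\iota_2$ and $D=\kappa_1(A)\cup\kappa_2(B)$. -}

module Defs where

open import Level using (0ℓ)
open import Data.Product using (Σ; ∃; _×_; _,_)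
open import Data.Sum using (_⊎_)
open import Relation.Binary.PropositionalEquality using (_≡_)
open import Relation.Binary.Structures using (IsPartialOrder)
open import Function.Definitions using (Injective)

record MonPoset : Set₁ where
  field
    Carrier        : Set
    _≤_            : Carrier → Carrier → Set
    isPartialOrder : IsPartialOrder _≡_ _≤_
    f              : Carrier → Carrier → Carrier
    monoˡ          : ∀ {x x′ y} → x ≤ x′ → f x y ≤ f x′ y
    monoʳ          : ∀ {x y y′} → y ≤ y′ → f x y ≤ f x y′

open MonPoset

record Embedding (A B : MonPoset) : Set where
  field
    map        : Carrier A → Carrier B
    injective  : Injective _≡_ _≡_ map
    preserves-f : ∀ x y → map (f A x y) ≡ f B (map x) (map y)
    preserves-≤ : ∀ {x y} → _≤_ A x y → _≤_ B (map x) (map y)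
    reflects-≤  : ∀ {x y} → _≤_ B (map x) (map y) → _≤_ A x y

open Embedding

APU : Set₁
APU = (A B C : MonPoset) (ι₁ : Embedding C A) (ι₂ : Embedding C B) →
      Σ MonPoset λ D → Σ (Embedding A D) λ κ₁ → Σ (Embedding B D) λ κ₂ →
        (∀ c → map κ₁ (map ι₁ c) ≡ map κ₂ (map ι₂ c)) ×
        (∀ (d : Carrier D) → (∃ λ a → map κ₁ a ≡ d) ⊎ (∃ λ b → map κ₂ b ≡ d))

{-# OPTIONS --safe #-}
module Submission where

open import Data.Bool.Base using (false; true; f≤t)
open import Data.Bool.Properties using (≤-isPartialOrder)
open import Data.Product using (∃; _,_)
open import Data.Sum using (_⊎_; inj₁; inj₂)
open import Data.Unit using (tt)
open import Data.Unit.Properties using (≡-isPartialOrder)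
open import Function.Base using (id; const)
open import Relation.Binary.PropositionalEquality
open import Relation.Binary.Structures using (IsPartialOrder)
open import Relation.Nullary using (¬_)

open import Defs

open Embedding

-- Amalgamate the chain false < true carrying the left projection with the
-- same chain carrying the right projection, over the common point true.
-- Writing a, b for the two copies of false and c for true in an amalgam D,
-- the element f a b lies below both a = f a c and b = f c b. It cannot be c
-- (as c ≰ a), nor a (then c = f c a ≤ f c b = b), nor b (then c = f b c ≤ f a c = a),
-- so D is not the union of the two images.

module _ {A : Set} {_≤_ : A → A → Set} (po : IsPartialOrder _≡_ _≤_) where

  leftProjection : MonPoset
  leftProjection = record
    { Carrier = A ; _≤_ = _≤_ ; isPartialOrder = po
    ; f = λ x _ → x ; monoˡ = id ; monoʳ = const (IsPartialOrder.refl po) }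

  rightProjection : MonPoset
  rightProjection = record
    { Carrier = A ; _≤_ = _≤_ ; isPartialOrder = po
    ; f = λ _ y → y ; monoˡ = const (IsPartialOrder.refl po) ; monoʳ = id }

trivial : MonPoset
trivial = leftProjection ≡-isPartialOrder

pointEmbedding : (P : MonPoset) (x : MonPoset.Carrier P) →
                 MonPoset.f P x x ≡ x → Embedding trivial P
pointEmbedding P x idem = record
  { map = const x ; injective = const refl ; preserves-f = λ _ _ → sym idem
  ; preserves-≤ = const (IsPartialOrder.refl (MonPoset.isPartialOrder P))
  ; reflects-≤ = const refl }

chainˡ chainʳ : MonPoset
chainˡ = leftProjection ≤-isPartialOrder
chainʳ = rightProjection ≤-isPartialOrder

module ChainAmalgam {D : MonPoset} (κ₁ : Embedding chainˡ D) (κ₂ : Embedding chainʳ D)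
                    (glue : map κ₁ true ≡ map κ₂ true) where

  open MonPoset D

  a b c d : Carrier
  a = map κ₁ false
  b = map κ₂ false
  c = map κ₁ true
  d = f a b

  a≤c : a ≤ c
  a≤c = preserves-≤ κ₁ f≤t

  b≤c : b ≤ c
  b≤c = subst (b ≤_) (sym glue) (preserves-≤ κ₂ f≤t)

  c≰a : ¬ c ≤ a
  c≰a c≤a with reflects-≤ κ₁ c≤a
  ... | ()

  c≰b : ¬ c ≤ b
  c≰b c≤b with reflects-≤ κ₂ (subst (_≤ b) glue c≤b)
  ... | ()

  fac≡a : f a c ≡ a
  fac≡a = sym (preserves-f κ₁ false true)

  fca≡c : f c a ≡ c
  fca≡c = sym (preserves-f κ₁ true false)

  fcb≡b : f c b ≡ b
  fcb≡b = subst (λ z → f z b ≡ b) (sym glue) (sym (preserves-f κ₂ true false))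

  fbc≡c : f b c ≡ c
  fbc≡c = subst (λ z → f b z ≡ z) (sym glue) (sym (preserves-f κ₂ false true))

  d≤a : d ≤ a
  d≤a = subst (d ≤_) fac≡a (monoʳ b≤c)

  d≤b : d ≤ b
  d≤b = subst (d ≤_) fcb≡b (monoˡ a≤c)

  c≢d : c ≢ d
  c≢d c≡d = c≰a (subst (_≤ a) (sym c≡d) d≤a)

  a≢d : a ≢ d
  a≢d a≡d = c≰b (subst₂ _≤_ fca≡c fcb≡b (monoʳ a≤b))
    where
    a≤b : a ≤ b
    a≤b = subst (_≤ b) (sym a≡d) d≤b

  b≢d : b ≢ d
  b≢d b≡d = c≰a (subst₂ _≤_ fbc≡c fac≡a (monoˡ b≤a))
    where
    b≤a : b ≤ a
    b≤a = subst (_≤ a) (sym b≡d) d≤a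

  d∉images : ¬ ((∃ λ x → map κ₁ x ≡ d) ⊎ (∃ λ y → map κ₂ y ≡ d))
  d∉images (inj₁ (false , e)) = a≢d e
  d∉images (inj₁ (true  , e)) = c≢d e
  d∉images (inj₂ (false , e)) = b≢d e
  d∉images (inj₂ (true  , e)) = c≢d (trans glue e)

proposition7p5 : ¬ APU
proposition7p5 apu
  with apu chainˡ chainʳ trivial (pointEmbedding chainˡ true refl) (pointEmbedding chainʳ true refl)
... | D , κ₁ , κ₂ , glue , union = d∉images (union d)
  where open ChainAmalgam κ₁ κ₂ (glue tt)
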